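{- Let $H_0,\ldots,H_n$ be sets of hypotheses over a common alphabet such that the one-step function of $H_i$ is affine for every $i<n$; write $H_{<j}=\bigcup_{i<j}H_i$. If for every $j\le n$ we have either (1) for all $i<j$, $H_i\circ H_j\subseteq H_j^\star\circ H_{<j}^{=}$, or (2) for all $i<j$, $H_i\circ H_j\subseteq H_j^{=}\circ H_{<j}^\star$, then $H_{<n+1}^\star=H_n^\star\circ\cdots\circ H_0^\star$.
   Context: Regular expressions over an alphabet $\Sigma$ with usual language $\llbracket e\rrbracket$. A hypothesis is a pair $e\le f$ of regular expressions. For a set $G$ of hypotheses, the one-step function on languages is $G(L)=\bigcup\{u\llbracket e\rrbracket v\mid e\le f\in G,\ u,v\in\Sigma^*,\ u\llbracket f\rrbracket v\subseteq L\}$ (the name $G$ denotes both the set and this function; the one-step function of a union of sets is the union of the one-step functions), and $G^\star$ is the least closure operator above it, i.e. $G^\star(L)$ is the smallest language containing $L$ with $G(G^\star(L))\subseteq G^\star(L)$. For a function $g$ on languages, $g^{=}(L)=g(L)\cup L$. A function on languages is affine if it preserves all non-empty unions. Functions are composed with $\circ$ and compared pointwise by inclusion. -}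

module Defs where

open import Data.Nat using (ℕ; zero; suc; _<_)
open import Data.List using (List; []; _∷_; _++_)
open import Data.Product using (Σ; ∃; _×_; _,_)
open import Data.Sum using (_⊎_)
open import Relation.Binary.PropositionalEquality using (_≡_)

module _ (A : Set) where

  Word : Set
  Word = List A

  Lang : Set₁
  Lang = Word → Set

  data RegExp : Set where
    ∅ε  : RegExp
    ηε  : RegExp
    lit : A → RegExp
    _+ε_ : RegExp → RegExp → RegExp
    _·ε_ : RegExp → RegExp → RegExp
    _*ε  : RegExp → RegExp

  data ⟦_⟧ : RegExp → Lang where
    ⟦η⟧   : ⟦ ηε ⟧ []
    ⟦lit⟧ : ∀ a → ⟦ lit a ⟧ (a ∷ [])
    ⟦+l⟧  : ∀ {e f w} → ⟦ e ⟧ w → ⟦ e +ε f ⟧ w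
    ⟦+r⟧  : ∀ {e f w} → ⟦ f ⟧ w → ⟦ e +ε f ⟧ w
    ⟦·⟧   : ∀ {e f u v} → ⟦ e ⟧ u → ⟦ f ⟧ v → ⟦ e ·ε f ⟧ (u ++ v)
    ⟦*0⟧  : ∀ {e} → ⟦ e *ε ⟧ []
    ⟦*s⟧  : ∀ {e u v} → ⟦ e ⟧ u → ⟦ e *ε ⟧ v → ⟦ e *ε ⟧ (u ++ v)

  -- a set of hypotheses e ≤ f : a predicate on pairs (e , f)
  Hyps : Set₁
  Hyps = RegExp → RegExp → Set

  -- one-step function:
  -- G(L) = ⋃ { u⟦e⟧v | e ≤ f ∈ G, u,v ∈ Σ*, u⟦f⟧v ⊆ L }
  record OneStep (G : Hyps) (L : Lang) (w : Word) : Set where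
    inductive
    constructor onestep
    field
      e f : RegExp
      hyp : G e f
      u v x : Word
      x∈e : ⟦ e ⟧ x
      w≡  : w ≡ u ++ (x ++ v)
      f⊆  : ∀ y → ⟦ f ⟧ y → L (u ++ (y ++ v))

  data Star (G : Hyps) (L : Lang) : Lang where
    base : ∀ {w} → L w → Star G L w
    step : ∀ {w} → OneStep G (Star G L) w → Star G L w

  _∘L_ : (Lang → Lang) → (Lang → Lang) → (Lang → Lang)
  (g ∘L h) L = g (h L)

  _⁼ : (Lang → Lang) → (Lang → Lang)
  (g ⁼) L w = g L w ⊎ L w

  _⊑_ : (Lang → Lang) → (Lang → Lang) → Set₁
  g ⊑ h = ∀ L w → g L w → h L w

  _≋_ : (Lang → Lang) → (Lang → Lang) → Set₁
  g ≋ h = (g ⊑ h) × (h ⊑ g)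

  ⋃ : {I : Set} → (I → Lang) → Lang
  ⋃ {I} Ls w = Σ I λ i → Ls i w

  -- affine: preserves all non-empty unions
  Affine : (Lang → Lang) → Set₁
  Affine g = ∀ (I : Set) → I → (Ls : I → Lang) →
    (∀ w → g (⋃ Ls) w → ⋃ (λ i → g (Ls i)) w) ×
    (∀ w → ⋃ (λ i → g (Ls i)) w → g (⋃ Ls) w)

  H< : (ℕ → Hyps) → ℕ → Hyps
  H< H j e f = Σ ℕ λ i → i < j × H i e f

  StarChain : (ℕ → Hyps) → ℕ → (Lang → Lang)
  StarChain H zero    = Star (H zero)
  StarChain H (suc k) = Star (H (suc k)) ∘L StarChain H k

-- Both inclusions go by induction on n, and the inductive step is a statement about
-- two sets of hypotheses G (playing H_{<j}) and K (playing H_j): if G ∘ K⋆ ⊆ K⋆ ∘ G⋆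
-- then (G ∪ K)⋆ ⊆ K⋆ ∘ G⋆. Either exchange condition yields G ∘ K⋆ ⊆ K⋆ ∘ G⋆ by an
-- induction along K⋆. That induction needs an invariant on words rather than on
-- languages, and affineness of G supplies it: to bound G Z it is enough to bound
-- G {w} for every w ∈ Z, plus G X for one fixed X that keeps the union non-empty.
module Submission where

open import Defs
open import Data.Nat using (ℕ; zero; suc; _<_; _≤_; s≤s; z≤n)
open import Data.Nat.Properties using (≤-refl; n≤1+n; m≤n⇒m≤1+n; m<n⇒m<1+n; n<1+n; <-≤-trans; m<1+n⇒m<n∨m≡n)
open import Data.Sum as Sum using (_⊎_; inj₁; inj₂; [_,_])
open import Data.Product using (Σ; _×_; _,_; proj₁; proj₂)
open import Data.Unit using (⊤; tt)
open import Relation.Binary.PropositionalEquality using (_≡_; refl; subst; sym)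

module _ {A : Set} where

  _⊆_ : Lang A → Lang A → Set
  X ⊆ Y = ∀ w → X w → Y w

  _⊆ʰ_ : Hyps A → Hyps A → Set
  G ⊆ʰ K = ∀ e f → G e f → K e f

  _∪ʰ_ : Hyps A → Hyps A → Hyps A
  (G ∪ʰ K) e f = G e f ⊎ K e f

  ｛_｝ : Word A → Lang A
  ｛ w ｝ v = v ≡ w

  ｛｝⊆ : ∀ {Y : Lang A} {w} → Y w → ｛ w ｝ ⊆ Y
  ｛｝⊆ {Y} y v v≡w = subst Y (sym v≡w) y

  Monotone : (Lang A → Lang A) → Set₁
  Monotone g = ∀ {X Y} → X ⊆ Y → g X ⊆ g Y

  ⋃-monotone : ∀ {g} → Monotone g → ∀ {I} (Ls : I → Lang A) →
    ⋃ A (λ i → g (Ls i)) ⊆ g (⋃ A Ls)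
  ⋃-monotone g-mono Ls w (i , p) = g-mono (λ _ q → i , q) w p

  affine-⊆-pointwise : ∀ {g} → Monotone g → Affine A g → ∀ {X Z R : Lang A} →
    g X ⊆ R → (∀ w → Z w → g ｛ w ｝ ⊆ R) → g Z ⊆ R
  affine-⊆-pointwise {g} g-mono g-affine {X} {Z} {R} gX⊆R pointwise w p
    with proj₁ (g-affine Index (inj₁ tt) Ls) w (g-mono Z⊆⋃Ls w p)
    where
    Index : Set
    Index = ⊤ ⊎ Σ (Word A) Z
    Ls : Index → Lang A
    Ls (inj₁ _)       = X
    Ls (inj₂ (v , _)) = ｛ v ｝
    Z⊆⋃Ls : Z ⊆ ⋃ A Ls
    Z⊆⋃Ls v z = inj₂ (v , z) , refl
  ... | inj₁ _       , q = gX⊆R w q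
  ... | inj₂ (v , z) , q = pointwise v z w q

  module _ {G : Hyps A} where

    Star-induction : ∀ {L P : Lang A} → L ⊆ P → OneStep A G P ⊆ P → Star A G L ⊆ P
    Star-induction L⊆P closed w (base p) = L⊆P w p
    Star-induction L⊆P closed w (step (onestep e f h u v x x∈e w≡ f⊆)) =
      closed w (onestep e f h u v x x∈e w≡ (λ y y∈f → Star-induction L⊆P closed _ (f⊆ y y∈f)))

    OneStep-mono : Monotone (OneStep A G)
    OneStep-mono X⊆Y w (onestep e f h u v x x∈e w≡ f⊆) =
      onestep e f h u v x x∈e w≡ (λ y y∈f → X⊆Y _ (f⊆ y y∈f))

    Star-mono : Monotone (Star A G)
    Star-mono X⊆Y = Star-induction (λ w p → base (X⊆Y w p)) (λ _ → step)

    Star-idem : ∀ {X} → Star A G (Star A G X) ⊆ Star A G X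
    Star-idem = Star-induction (λ _ p → p) (λ _ → step)

    OneStep⊆Star : ∀ {X} → OneStep A G X ⊆ Star A G X
    OneStep⊆Star w p = step (OneStep-mono (λ _ → base) w p)

    Star-affine : Affine A (OneStep A G) → Affine A (Star A G)
    Star-affine G-affine I i Ls = Star⋃⊆⋃Star , ⋃-monotone Star-mono Ls
      where
      Star⋃⊆⋃Star : Star A G (⋃ A Ls) ⊆ ⋃ A (λ j → Star A G (Ls j))
      Star⋃⊆⋃Star = Star-induction (λ _ (j , p) → j , base p) λ w p →
        let j , q = proj₁ (G-affine I i (λ j → Star A G (Ls j))) w p in j , step q

  OneStep-monoʰ : ∀ {G K : Hyps A} {X} → G ⊆ʰ K → OneStep A G X ⊆ OneStep A K X
  OneStep-monoʰ G⊆K w (onestep e f h u v x x∈e w≡ f⊆) = onestep e f (G⊆K e f h) u v x x∈e w≡ f⊆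

  Star-monoʰ : ∀ {G K : Hyps A} {X} → G ⊆ʰ K → Star A G X ⊆ Star A K X
  Star-monoʰ G⊆K = Star-induction (λ _ → base) (λ w p → step (OneStep-monoʰ G⊆K w p))

  OneStep-∪ʰ : ∀ {G K : Hyps A} {X} w →
    OneStep A (G ∪ʰ K) X w → OneStep A G X w ⊎ OneStep A K X w
  OneStep-∪ʰ w (onestep e f (inj₁ g) u v x x∈e w≡ f⊆) = inj₁ (onestep e f g u v x x∈e w≡ f⊆)
  OneStep-∪ʰ w (onestep e f (inj₂ k) u v x x∈e w≡ f⊆) = inj₂ (onestep e f k u v x x∈e w≡ f⊆)

  Star-⊆-Star∘Star : ∀ {G K U : Hyps A} → U ⊆ʰ (G ∪ʰ K) →
    (∀ X → OneStep A G (Star A K X) ⊆ Star A K (Star A G X)) →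
    ∀ L → Star A U L ⊆ Star A K (Star A G L)
  Star-⊆-Star∘Star {G} U⊆G∪K exchange L = Star-induction (λ w p → base (base p)) closed
    where
    closed : OneStep A _ (Star A _ (Star A G L)) ⊆ Star A _ (Star A G L)
    closed w p with OneStep-∪ʰ w (OneStep-monoʰ U⊆G∪K w p)
    ... | inj₁ q = Star-mono Star-idem w (exchange (Star A G L) w q)
    ... | inj₂ q = step q

  module _ {G K : Hyps A} (G-affine : Affine A (OneStep A G)) where

    OneStep-Star-exchange₁ :
      (∀ L → OneStep A G (OneStep A K L) ⊆ Star A K (_⁼ A (OneStep A G) L)) →
      ∀ X → OneStep A G (Star A K X) ⊆ Star A K (Star A G X)
    OneStep-Star-exchange₁ exchange X w p =
      Star-mono (λ v → [ OneStep⊆Star v , base ]) w (GK⋆X⊆R w p)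
      where
      R : Lang A
      R = Star A K (_⁼ A (OneStep A G) X)
      GX⊆R : OneStep A G X ⊆ R
      GX⊆R w p = base (inj₁ p)
      Good : Lang A
      Good w = R w × OneStep A G ｛ w ｝ ⊆ R
      GGood⊆R : OneStep A G Good ⊆ R
      GGood⊆R = affine-⊆-pointwise OneStep-mono G-affine GX⊆R (λ _ → proj₂)
      X⊆Good : X ⊆ Good
      X⊆Good w x = base (inj₂ x) , λ v q → GX⊆R v (OneStep-mono (｛｝⊆ x) v q)
      KGood⊆Good : OneStep A K Good ⊆ Good
      KGood⊆Good w p = step (OneStep-mono (λ _ → proj₁) w p) , λ v q →
        Star-idem v (Star-mono (λ u → [ GGood⊆R u , proj₁ ])
                               v (exchange Good v (OneStep-mono (｛｝⊆ p) v q)))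
      GK⋆X⊆R : OneStep A G (Star A K X) ⊆ R
      GK⋆X⊆R = affine-⊆-pointwise OneStep-mono G-affine GX⊆R
                 (λ w p → proj₂ (Star-induction X⊆Good KGood⊆Good w p))

    module _ (exchange : ∀ L → OneStep A G (OneStep A K L) ⊆ _⁼ A (OneStep A K) (Star A G L)) where

      Star-OneStep-exchange : ∀ X → Star A G (OneStep A K X) ⊆ _⁼ A (OneStep A K) (Star A G X)
      Star-OneStep-exchange X =
        Star-induction (λ w p → inj₁ (OneStep-mono (λ _ → base) w p))
                       (affine-⊆-pointwise OneStep-mono G-affine (λ w p → inj₂ (step p)) pointwise)
        where
        pointwise : ∀ w → _⁼ A (OneStep A K) (Star A G X) w →
          OneStep A G ｛ w ｝ ⊆ _⁼ A (OneStep A K) (Star A G X)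
        pointwise w (inj₁ p) v q = Sum.map (OneStep-mono Star-idem v) (Star-idem v)
                                     (exchange (Star A G X) v (OneStep-mono (｛｝⊆ p) v q))
        pointwise w (inj₂ p) v q = inj₂ (step (OneStep-mono (｛｝⊆ p) v q))

      OneStep-Star-exchange₂ : ∀ X → OneStep A G (Star A K X) ⊆ Star A K (Star A G X)
      OneStep-Star-exchange₂ X w p = G⋆K⋆X⊆R w (OneStep⊆Star w p)
        where
        R : Lang A
        R = Star A K (Star A G X)
        G⋆X⊆R : Star A G X ⊆ R
        G⋆X⊆R _ = base
        Good : Lang A
        Good w = Star A G ｛ w ｝ ⊆ R
        G⋆Good⊆R : Star A G Good ⊆ R
        G⋆Good⊆R = affine-⊆-pointwise Star-mono (Star-affine G-affine) G⋆X⊆R (λ _ g → g)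
        KGood⊆Good : OneStep A K Good ⊆ Good
        KGood⊆Good w p v q =
          [ (λ r → step (OneStep-mono G⋆Good⊆R v r)) , G⋆Good⊆R v ]
            (Star-OneStep-exchange Good v (Star-mono (｛｝⊆ p) v q))
        G⋆K⋆X⊆R : Star A G (Star A K X) ⊆ R
        G⋆K⋆X⊆R = affine-⊆-pointwise Star-mono (Star-affine G-affine) G⋆X⊆R
                    (Star-induction (λ w x v q → base (Star-mono (｛｝⊆ x) v q)) KGood⊆Good)

  module _ (H : ℕ → Hyps A) where

    H⊆ʰH< : ∀ {i j} → i < j → H i ⊆ʰ H< A H j
    H⊆ʰH< {i} i<j e f h = i , i<j , h

    H<-mono : ∀ {j k} → j ≤ k → H< A H j ⊆ʰ H< A H k
    H<-mono j≤k e f (i , i<j , h) = i , <-≤-trans i<j j≤k , h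

    H<-suc : ∀ j → H< A H (suc j) ⊆ʰ (H< A H j ∪ʰ H j)
    H<-suc j e f (i , i<1+j , h) with m<1+n⇒m<n∨m≡n i<1+j
    ... | inj₁ i<j  = inj₁ (i , i<j , h)
    ... | inj₂ refl = inj₂ h

    H<1⊆ʰH0 : H< A H 1 ⊆ʰ H zero
    H<1⊆ʰH0 e f (zero , _ , h) = h
    H<1⊆ʰH0 e f (suc i , s≤s () , h)

    OneStep-H< : ∀ {j X} w → OneStep A (H< A H j) X w → Σ ℕ λ i → i < j × OneStep A (H i) X w
    OneStep-H< w (onestep e f (i , i<j , h) u v x x∈e w≡ f⊆) = i , i<j , onestep e f h u v x x∈e w≡ f⊆

    H<-∘-⊑ : ∀ {j g F} → (∀ i → i < j → _⊑_ A (_∘L_ A (OneStep A (H i)) g) F) →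
      _⊑_ A (_∘L_ A (OneStep A (H< A H j)) g) F
    H<-∘-⊑ Hg⊑F L w p = let i , i<j , q = OneStep-H< w p in Hg⊑F i i<j L w q

    H<-affine : ∀ j → (∀ i → i < j → Affine A (OneStep A (H i))) → Affine A (OneStep A (H< A H j))
    H<-affine j H-affine I i Ls = distrib , ⋃-monotone OneStep-mono Ls
      where
      distrib : OneStep A (H< A H j) (⋃ A Ls) ⊆ ⋃ A (λ k → OneStep A (H< A H j) (Ls k))
      distrib w p =
        let l , l<j , q = OneStep-H< w p
            k , r = proj₁ (H-affine l l<j I i Ls) w q
        in k , OneStep-monoʰ (H⊆ʰH< l<j) w r

    Exchange : ℕ → Set₁
    Exchange j =
      (∀ i → i < j →
        _⊑_ A (_∘L_ A (OneStep A (H i)) (OneStep A (H j)))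
              (_∘L_ A (Star A (H j)) (_⁼ A (OneStep A (H< A H j)))))
      ⊎
      (∀ i → i < j →
        _⊑_ A (_∘L_ A (OneStep A (H i)) (OneStep A (H j)))
              (_∘L_ A (_⁼ A (OneStep A (H j))) (Star A (H< A H j))))

    Star-H<-suc : ∀ j → Affine A (OneStep A (H< A H j)) → Exchange j →
      ∀ L → Star A (H< A H (suc j)) L ⊆ Star A (H j) (Star A (H< A H j) L)
    Star-H<-suc j H<-affine exchange =
      Star-⊆-Star∘Star (H<-suc j)
        ([ (λ c → OneStep-Star-exchange₁ H<-affine (H<-∘-⊑ c))
         , (λ c → OneStep-Star-exchange₂ H<-affine (H<-∘-⊑ c)) ] exchange)

    Star-H<⊑StarChain : ∀ n → (∀ i → i < n → Affine A (OneStep A (H i))) →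
      (∀ j → j ≤ n → Exchange j) → _⊑_ A (Star A (H< A H (suc n))) (StarChain A H n)
    Star-H<⊑StarChain zero    _        _        L = Star-monoʰ H<1⊆ʰH0
    Star-H<⊑StarChain (suc n) H-affine exchange L w p =
      Star-mono (Star-H<⊑StarChain n (λ i i<n → H-affine i (m<n⇒m<1+n i<n))
                                     (λ j j≤n → exchange j (m≤n⇒m≤1+n j≤n)) L)
        w (Star-H<-suc (suc n) (H<-affine (suc n) H-affine) (exchange (suc n) ≤-refl) L w p)

    StarChain⊑Star-H< : ∀ n → _⊑_ A (StarChain A H n) (Star A (H< A H (suc n)))
    StarChain⊑Star-H< zero    L = Star-monoʰ (H⊆ʰH< (s≤s z≤n))
    StarChain⊑Star-H< (suc n) L w p =
      Star-idem w (Star-monoʰ (H⊆ʰH< (n<1+n (suc n))) w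
        (Star-mono (λ v q → Star-monoʰ (H<-mono (n≤1+n (suc n))) v (StarChain⊑Star-H< n L v q)) w p))

proposition5p3 : (A : Set) (H : ℕ → Hyps A) (n : ℕ) →
    (∀ i → i < n → Affine A (OneStep A (H i))) →
    (∀ j → j ≤ n →
      (∀ i → i < j →
        _⊑_ A (_∘L_ A (OneStep A (H i)) (OneStep A (H j)))
              (_∘L_ A (Star A (H j)) (_⁼ A (OneStep A (H< A H j)))))
      ⊎
      (∀ i → i < j →
        _⊑_ A (_∘L_ A (OneStep A (H i)) (OneStep A (H j)))
              (_∘L_ A (_⁼ A (OneStep A (H j))) (Star A (H< A H j))))) →
    _≋_ A (Star A (H< A H (suc n))) (StarChain A H n)
proposition5p3 A H n H-affine exchange =
  Star-H<⊑StarChain H n H-affine exchange , StarChain⊑Star-H< H n
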